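{- Let $G$ be a bipartite multigraph. Then $\omega(L(G)^2) \leq \frac{1}{4}\sigma(G)^2$, where $\sigma(G)=\max_{xy\in E(G)}(d_G(x)+d_G(y))$.
   Context: For a (multi)graph $G$, $L(G)^2$ denotes the square of the line graph of $G$: its vertices are the edges of $G$, and two distinct edges $e,f$ of $G$ are adjacent in $L(G)^2$ if and only if they are at distance at most $1$ in $L(G)$ or at distance $2$ in $L(G)$, i.e. $e$ and $f$ share an end, or some edge of $G$ joins an end of $e$ to an end of $f$. $\omega$ denotes the clique number. Degrees $d_G$ in a multigraph count edges with multiplicity. $\sigma(G)$ is called the Ore-degree of $G$ (taken to be $0$ if $G$ has no edges). -}

module Defs where

open import Data.Nat using (ℕ; zero; suc; _⊔_)
open import Data.Fin using (Fin)
open import Data.Fin.Properties using (_≟_)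
open import Data.List using (List; map; foldr; allFin)
open import Data.Product using (_×_; Σ; proj₁; proj₂; _,_)
open import Data.Sum using (_⊎_)
open import Relation.Binary.PropositionalEquality using (_≡_)
open import Relation.Nullary using (yes; no)

-- Parallel edges are allowed (E need not be injective).
record BipMultigraph : Set where
  field
    a b m : ℕ
    E : Fin m → Fin a × Fin b
open BipMultigraph public

countFin : ∀ {m} {X : Set} → (Fin m → X) → ((x y : X) → Relation.Nullary.Dec (x ≡ y)) → X → ℕ
countFin {zero} f d x = 0
countFin {suc m} f d x with d (f Fin.zero) x
... | yes _ = suc (countFin (λ i → f (Fin.suc i)) d x)
... | no _ = countFin (λ i → f (Fin.suc i)) d x

degA : (G : BipMultigraph) → Fin (a G) → ℕ
degA G x = countFin (λ k → proj₁ (E G k)) _≟_ x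

degB : (G : BipMultigraph) → Fin (b G) → ℕ
degB G y = countFin (λ k → proj₂ (E G k)) _≟_ y

-- Ore-degree σ(G) = max over edges xy of d(x) + d(y), and 0 if no edges
σ : BipMultigraph → ℕ
σ G = foldr _⊔_ 0 (map (λ k → degA G (proj₁ (E G k)) Data.Nat.+ degB G (proj₂ (E G k))) (allFin (m G)))

-- adjacency in L(G)²  (for distinct edges e, f): they share an end, or some
-- edge g of G joins an end of e to an end of f.  Since G is bipartite, an edge
-- joining an end of e to an end of f goes from the A-end of one to the B-end of the other.
AdjL² : (G : BipMultigraph) → Fin (m G) → Fin (m G) → Set
AdjL² G e f =
  (proj₁ (E G e) ≡ proj₁ (E G f)) ⊎ (proj₂ (E G e) ≡ proj₂ (E G f)) ⊎
  Σ (Fin (m G)) (λ g →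
    ((proj₁ (E G g) ≡ proj₁ (E G e)) × (proj₂ (E G g) ≡ proj₂ (E G f))) ⊎
    ((proj₁ (E G g) ≡ proj₁ (E G f)) × (proj₂ (E G g) ≡ proj₂ (E G e))))

-- Let x be an A-vertex incident with the largest number of clique edges.  For any
-- A-vertex y, either the B-end of every clique edge at y is joined to x, or some
-- clique edge e₁ at y is not reached from x; then, since e₁ is adjacent in L(G)²
-- to every clique edge at x, the B-ends of those edges are all joined to y.  In both
-- cases the number of clique edges at y is at most the number of walks x β y of
-- length two (using the maximality of x in the second case, and that the walk count
-- is symmetric).  Summing over y, the clique has at most
-- Σ_{h ∋ x} d(B-end of h) ≤ d(x) (σ − d(x)) ≤ σ²/4 edges.

module Submission where

open import Defs
open import Data.Fin using (Fin; zero; suc; punchIn)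
open import Data.Fin.Properties using (_≟_; any?; punchInᵢ≢i)
open import Data.List using (List; []; _∷_; length; foldr; allFin)
open import Data.List.Extrema.Nat using (argmax; f[xs]≤f[argmax])
open import Data.List.Membership.Propositional using (_∈_)
open import Data.List.Membership.Propositional.Properties using (∈-map⁺; ∈-allFin)
open import Data.List.Properties using (foldr-preservesᵒ)
open import Data.List.Relation.Unary.All as All using ()
open import Data.List.Relation.Unary.All.Properties using (All¬⇒¬Any)
open import Data.List.Relation.Unary.AllPairs using (AllPairs; []; _∷_)
open import Data.List.Relation.Unary.Any as Any using (here; there)
open import Data.List.Relation.Unary.Unique.Propositional using (Unique)
open import Data.Nat using (ℕ; zero; suc; _+_; _*_; _∸_; _⊔_; _≤_; z≤n)
open import Data.Nat.Properties
  using (≤-trans; ≤-reflexive; ≤-total; _≤?_; ≰⇒≥; m≤m+n; +-mono-≤; *-monoʳ-≤; +-comm; *-comm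
        ; *-zeroʳ; *-identityˡ; *-identityʳ; m+[n∸m]≡n; m≤n⇒m∸n≡0; m+n≤o⇒m≤o∸n; m≤n⇒m≤n⊔o
        ; m≤n⇒m≤o⊔n; +-*-semiring; *-commutativeSemigroup; module ≤-Reasoning)
open import Data.Nat.Solver using (module +-*-Solver)
open import Algebra.Properties.Semiring.Sum +-*-semiring
  using (sum; sum-syntax; sum-remove; sum-cong-≗; sum-replicate-zero; ∑-comm; ∑-distrib-+
        ; *-distribˡ-sum; *-distribʳ-sum)
open import Algebra.Properties.CommutativeSemigroup *-commutativeSemigroup using (x∙yz≈y∙xz)
open import Data.Product using (∃; _×_; _,_; proj₁; proj₂)
open import Data.Sum using (inj₁; inj₂; [_,_]; [_,_]′)
open import Function using (_∘_)
open import Relation.Binary using (Rel; Symmetric; DecidableEquality)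
open import Relation.Binary.PropositionalEquality
  using (_≡_; _≢_; refl; sym; trans; cong; cong₂; subst; subst₂; module ≡-Reasoning)
open import Relation.Nullary using (Dec; yes; no; ¬_; ¬?; contradiction)
open import Relation.Nullary.Decidable using (_×-dec_; decidable-stable)

𝟙 : ∀ {p} {P : Set p} → Dec P → ℕ
𝟙 (yes _) = 1
𝟙 (no _)  = 0

𝟙-yes : ∀ {p} {P : Set p} (P? : Dec P) → P → 𝟙 P? ≡ 1
𝟙-yes (yes _) _ = refl
𝟙-yes (no ¬p) p = contradiction p ¬p

𝟙-no : ∀ {p} {P : Set p} (P? : Dec P) → ¬ P → 𝟙 P? ≡ 0
𝟙-no (yes p) ¬p = contradiction p ¬p
𝟙-no (no _)  _  = refl

𝟙-mono : ∀ {p q} {P : Set p} {Q : Set q} (P? : Dec P) (Q? : Dec Q) → (P → Q) → 𝟙 P? ≤ 𝟙 Q?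
𝟙-mono (yes p) Q? P→Q = ≤-reflexive (sym (𝟙-yes Q? (P→Q p)))
𝟙-mono (no _)  Q? P→Q = z≤n

𝟙-≟-sym : ∀ {a} {A : Set a} (_≟ₐ_ : DecidableEquality A) (x y : A) → 𝟙 (x ≟ₐ y) ≡ 𝟙 (y ≟ₐ x)
𝟙-≟-sym _≟ₐ_ x y with x ≟ₐ y
... | yes x≡y = sym (𝟙-yes (y ≟ₐ x) (sym x≡y))
... | no x≢y  = sym (𝟙-no (y ≟ₐ x) (x≢y ∘ sym))

sum-mono-≤ : ∀ {n} {f g : Fin n → ℕ} → (∀ i → f i ≤ g i) → sum f ≤ sum g
sum-mono-≤ {zero}  f≤g = z≤n
sum-mono-≤ {suc n} f≤g = +-mono-≤ (f≤g zero) (sum-mono-≤ (f≤g ∘ suc))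

term≤sum : ∀ {n} (f : Fin n → ℕ) (i : Fin n) → f i ≤ sum f
term≤sum {suc n} f i = ≤-trans (m≤m+n (f i) _) (≤-reflexive (sym (sum-remove {i = i} f)))

∑-𝟙-≟ : ∀ {n} (x : Fin n) → ∑[ i < n ] 𝟙 (x ≟ i) ≡ 1
∑-𝟙-≟ {suc n} x = begin
  ∑[ i < suc n ] 𝟙 (x ≟ i)                     ≡⟨ sum-remove {i = x} (λ i → 𝟙 (x ≟ i)) ⟩
  𝟙 (x ≟ x) + ∑[ j < n ] 𝟙 (x ≟ punchIn x j)  ≡⟨ cong₂ _+_ (𝟙-yes (x ≟ x) refl) ∑-off-diagonal ⟩
  1                                             ∎
  where
  open ≡-Reasoning
  ∑-off-diagonal : ∑[ j < n ] 𝟙 (x ≟ punchIn x j) ≡ 0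
  ∑-off-diagonal = trans (sum-cong-≗ (λ j → 𝟙-no (x ≟ punchIn x j) (punchInᵢ≢i x j ∘ sym)))
                         (sum-replicate-zero n)

countFin≡∑𝟙 : ∀ {n} {X : Set} (f : Fin n → X) (_≟ₓ_ : DecidableEquality X) (x : X) →
              countFin f _≟ₓ_ x ≡ ∑[ i < n ] 𝟙 (f i ≟ₓ x)
countFin≡∑𝟙 {zero}  f _≟ₓ_ x = refl
countFin≡∑𝟙 {suc n} f _≟ₓ_ x with f zero ≟ₓ x
... | yes _ = cong suc (countFin≡∑𝟙 (f ∘ suc) _≟ₓ_ x)
... | no _  = countFin≡∑𝟙 (f ∘ suc) _≟ₓ_ x

infix 4 _∈?_
_∈?_ : ∀ {n} (x : Fin n) (xs : List (Fin n)) → Dec (x ∈ xs)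
x ∈? xs = Any.any? (x ≟_) xs

length≤∑𝟙∈ : ∀ {n} {xs : List (Fin n)} → Unique xs → length xs ≤ ∑[ i < n ] 𝟙 (i ∈? xs)
length≤∑𝟙∈ {n} {[]}     []             = z≤n
length≤∑𝟙∈ {n} {x ∷ xs} (x∉xs ∷ uniq) = begin
  1 + length xs
    ≤⟨ +-mono-≤ (≤-reflexive (sym (∑-𝟙-≟ x))) (length≤∑𝟙∈ uniq) ⟩
  ∑[ i < n ] 𝟙 (x ≟ i) + ∑[ i < n ] 𝟙 (i ∈? xs)
    ≡⟨ sym (∑-distrib-+ (λ i → 𝟙 (x ≟ i)) (λ i → 𝟙 (i ∈? xs))) ⟩
  ∑[ i < n ] (𝟙 (x ≟ i) + 𝟙 (i ∈? xs))
    ≤⟨ sum-mono-≤ 𝟙-cons ⟩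
  ∑[ i < n ] 𝟙 (i ∈? x ∷ xs)
    ∎
  where
  open ≤-Reasoning
  𝟙-cons : ∀ i → 𝟙 (x ≟ i) + 𝟙 (i ∈? xs) ≤ 𝟙 (i ∈? x ∷ xs)
  𝟙-cons i with x ≟ i
  ... | yes refl = ≤-reflexive (trans (cong suc (𝟙-no (x ∈? xs) (All¬⇒¬Any x∉xs)))
                                     (sym (𝟙-yes (x ∈? x ∷ xs) (here refl))))
  ... | no _     = 𝟙-mono (i ∈? xs) (i ∈? x ∷ xs) there

allPairs-∈ : ∀ {a r} {A : Set a} {R : Rel A r} → Symmetric R → ∀ {xs x y} →
             AllPairs R xs → x ∈ xs → y ∈ xs → x ≢ y → R x y
allPairs-∈ R-sym (_ ∷ _)     (here refl) (here refl) x≢y = contradiction refl x≢y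
allPairs-∈ R-sym (Rx ∷ _)    (here refl) (there y∈)  _   = All.lookup Rx y∈
allPairs-∈ R-sym (Ry ∷ _)    (there x∈)  (here refl) _   = R-sym (All.lookup Ry x∈)
allPairs-∈ R-sym (_ ∷ pairs) (there x∈)  (there y∈)  x≢y = allPairs-∈ R-sym pairs x∈ y∈ x≢y

∈⇒≤foldr-⊔ : ∀ {v xs} → v ∈ xs → v ≤ foldr _⊔_ 0 xs
∈⇒≤foldr-⊔ {v} {xs} v∈xs = foldr-preservesᵒ {P = v ≤_}
  (λ x y → [ m≤n⇒m≤n⊔o y , m≤n⇒m≤o⊔n x ]) 0 xs (inj₂ (Any.map ≤-reflexive v∈xs))

4*[m*n]≤[m+n]*[m+n] : ∀ m n → 4 * (m * n) ≤ (m + n) * (m + n)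
4*[m*n]≤[m+n]*[m+n] m n = [ ordered , swapped ]′ (≤-total m n)
  where
  open +-*-Solver
  -- (m + n)² = 4mn + (n − m)², written with n = m + d
  square-expansion : ∀ m d → (m + (m + d)) * (m + (m + d)) ≡ 4 * (m * (m + d)) + d * d
  square-expansion = solve 2 (λ m d → (m :+ (m :+ d)) :* (m :+ (m :+ d))
                                   := con 4 :* (m :* (m :+ d)) :+ d :* d) refl
  ordered : ∀ {m n} → m ≤ n → 4 * (m * n) ≤ (m + n) * (m + n)
  ordered {m} {n} m≤n = subst (λ n → 4 * (m * n) ≤ (m + n) * (m + n)) (m+[n∸m]≡n m≤n)
    (≤-trans (m≤m+n _ _) (≤-reflexive (sym (square-expansion m (n ∸ m)))))
  swapped : n ≤ m → 4 * (m * n) ≤ (m + n) * (m + n)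
  swapped n≤m = subst₂ _≤_ (cong (4 *_) (*-comm n m)) (cong (λ s → s * s) (+-comm n m)) (ordered n≤m)

4*[m*[n∸m]]≤n*n : ∀ m n → 4 * (m * (n ∸ m)) ≤ n * n
4*[m*[n∸m]]≤n*n m n with m ≤? n
... | yes m≤n = subst (λ k → 4 * (m * (n ∸ m)) ≤ k * k) (m+[n∸m]≡n m≤n)
                      (4*[m*n]≤[m+n]*[m+n] m (n ∸ m))
... | no m≰n  = subst (λ k → 4 * (m * k) ≤ n * n) (sym (m≤n⇒m∸n≡0 (≰⇒≥ m≰n)))
                      (subst (λ k → 4 * k ≤ n * n) (sym (*-zeroʳ m)) z≤n)

module _ (G : BipMultigraph) where

  endA : Fin (m G) → Fin (a G)
  endA e = proj₁ (E G e)

  endB : Fin (m G) → Fin (b G)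
  endB e = proj₂ (E G e)

  Reaches : Fin (a G) → Fin (m G) → Set
  Reaches x e = ∃ λ g → endA g ≡ x × endB g ≡ endB e

  reaches? : ∀ x e → Dec (Reaches x e)
  reaches? x e = any? (λ g → (endA g ≟ x) ×-dec (endB g ≟ endB e))

  AdjL²-sym : Symmetric (AdjL² G)
  AdjL²-sym (inj₁ sameA)                   = inj₁ (sym sameA)
  AdjL²-sym (inj₂ (inj₁ sameB))            = inj₂ (inj₁ (sym sameB))
  AdjL²-sym (inj₂ (inj₂ (g , inj₁ joins))) = inj₂ (inj₂ (g , inj₂ joins))
  AdjL²-sym (inj₂ (inj₂ (g , inj₂ joins))) = inj₂ (inj₂ (g , inj₁ joins))

  AdjL²⇒Reaches : ∀ {e f} → AdjL² G e f → ¬ Reaches (endA e) f → Reaches (endA f) e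
  AdjL²⇒Reaches {f = f} (inj₁ sameA)                   ¬reach = contradiction (f , sym sameA , refl) ¬reach
  AdjL²⇒Reaches {f = f} (inj₂ (inj₁ sameB))            _      = f , refl , sym sameB
  AdjL²⇒Reaches         (inj₂ (inj₂ (g , inj₁ joins))) ¬reach = contradiction (g , joins) ¬reach
  AdjL²⇒Reaches         (inj₂ (inj₂ (g , inj₂ joins))) _      = g , joins

  multiplicity : Fin (a G) → Fin (b G) → ℕ
  multiplicity x y = ∑[ g < m G ] (𝟙 (endA g ≟ x) * 𝟙 (endB g ≟ y))

  walks₂ : Fin (a G) → Fin (a G) → ℕ
  walks₂ x y = ∑[ h < m G ] (𝟙 (endA h ≟ y) * multiplicity x (endB h))

  Reaches⇒1≤multiplicity : ∀ {x e} → Reaches x e → 1 ≤ multiplicity x (endB e)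
  Reaches⇒1≤multiplicity {x} {e} (g , g-at-x , g-at-endB-e) = ≤-trans
    (≤-reflexive (sym (cong₂ _*_ (𝟙-yes (endA g ≟ x) g-at-x) (𝟙-yes (endB g ≟ endB e) g-at-endB-e))))
    (term≤sum (λ g → 𝟙 (endA g ≟ x) * 𝟙 (endB g ≟ endB e)) g)

  ∑-multiplicity : ∀ y → ∑[ x < a G ] multiplicity x y ≡ degB G y
  ∑-multiplicity y = begin
    ∑[ x < a G ] ∑[ g < m G ] (𝟙 (endA g ≟ x) * 𝟙 (endB g ≟ y))
      ≡⟨ ∑-comm (λ x g → 𝟙 (endA g ≟ x) * 𝟙 (endB g ≟ y)) ⟩
    ∑[ g < m G ] ∑[ x < a G ] (𝟙 (endA g ≟ x) * 𝟙 (endB g ≟ y))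
      ≡⟨ sum-cong-≗ (λ g → sym (*-distribʳ-sum (𝟙 (endB g ≟ y)) (λ x → 𝟙 (endA g ≟ x)))) ⟩
    ∑[ g < m G ] ((∑[ x < a G ] 𝟙 (endA g ≟ x)) * 𝟙 (endB g ≟ y))
      ≡⟨ sum-cong-≗ (λ g → trans (cong (_* 𝟙 (endB g ≟ y)) (∑-𝟙-≟ (endA g))) (*-identityˡ _)) ⟩
    ∑[ g < m G ] 𝟙 (endB g ≟ y)
      ≡⟨ countFin≡∑𝟙 endB _≟_ y ⟨
    degB G y
      ∎
    where open ≡-Reasoning

  walks₂-sym : ∀ x y → walks₂ x y ≡ walks₂ y x
  walks₂-sym x y = begin
    ∑[ h < m G ] (𝟙 (endA h ≟ y) * ∑[ g < m G ] (𝟙 (endA g ≟ x) * 𝟙 (endB g ≟ endB h)))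
      ≡⟨ sum-cong-≗ (λ h → *-distribˡ-sum (𝟙 (endA h ≟ y)) (λ g → 𝟙 (endA g ≟ x) * 𝟙 (endB g ≟ endB h))) ⟩
    ∑[ h < m G ] ∑[ g < m G ] (𝟙 (endA h ≟ y) * (𝟙 (endA g ≟ x) * 𝟙 (endB g ≟ endB h)))
      ≡⟨ ∑-comm (λ h g → 𝟙 (endA h ≟ y) * (𝟙 (endA g ≟ x) * 𝟙 (endB g ≟ endB h))) ⟩
    ∑[ g < m G ] ∑[ h < m G ] (𝟙 (endA h ≟ y) * (𝟙 (endA g ≟ x) * 𝟙 (endB g ≟ endB h)))
      ≡⟨ sum-cong-≗ (λ g → sum-cong-≗ (λ h → reorder h g)) ⟩
    ∑[ g < m G ] ∑[ h < m G ] (𝟙 (endA g ≟ x) * (𝟙 (endA h ≟ y) * 𝟙 (endB h ≟ endB g)))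
      ≡⟨ sum-cong-≗ (λ g → *-distribˡ-sum (𝟙 (endA g ≟ x)) (λ h → 𝟙 (endA h ≟ y) * 𝟙 (endB h ≟ endB g))) ⟨
    ∑[ g < m G ] (𝟙 (endA g ≟ x) * ∑[ h < m G ] (𝟙 (endA h ≟ y) * 𝟙 (endB h ≟ endB g)))
      ∎
    where
    open ≡-Reasoning
    reorder : ∀ h g → 𝟙 (endA h ≟ y) * (𝟙 (endA g ≟ x) * 𝟙 (endB g ≟ endB h))
                    ≡ 𝟙 (endA g ≟ x) * (𝟙 (endA h ≟ y) * 𝟙 (endB h ≟ endB g))
    reorder h g = trans (cong (λ k → 𝟙 (endA h ≟ y) * (𝟙 (endA g ≟ x) * k)) (𝟙-≟-sym _≟_ (endB g) (endB h)))
                        (x∙yz≈y∙xz (𝟙 (endA h ≟ y)) (𝟙 (endA g ≟ x)) (𝟙 (endB h ≟ endB g)))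

  degB≤σ∸degA : ∀ h → degB G (endB h) ≤ σ G ∸ degA G (endA h)
  degB≤σ∸degA h = m+n≤o⇒m≤o∸n (degB G (endB h))
    (subst (_≤ σ G) (+-comm (degA G (endA h)) (degB G (endB h)))
      (∈⇒≤foldr-⊔ (∈-map⁺ (λ k → degA G (endA k) + degB G (endB k)) (∈-allFin h))))

  ∑walks₂≤degA*[σ∸degA] : ∀ x → ∑[ y < a G ] walks₂ x y ≤ degA G x * (σ G ∸ degA G x)
  ∑walks₂≤degA*[σ∸degA] x = begin
    ∑[ y < a G ] walks₂ x y
      ≡⟨ sum-cong-≗ (walks₂-sym x) ⟩
    ∑[ y < a G ] ∑[ h < m G ] (𝟙 (endA h ≟ x) * multiplicity y (endB h))
      ≡⟨ ∑-comm (λ y h → 𝟙 (endA h ≟ x) * multiplicity y (endB h)) ⟩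
    ∑[ h < m G ] ∑[ y < a G ] (𝟙 (endA h ≟ x) * multiplicity y (endB h))
      ≡⟨ sum-cong-≗ (λ h → *-distribˡ-sum (𝟙 (endA h ≟ x)) (λ y → multiplicity y (endB h))) ⟨
    ∑[ h < m G ] (𝟙 (endA h ≟ x) * ∑[ y < a G ] multiplicity y (endB h))
      ≡⟨ sum-cong-≗ (λ h → cong (𝟙 (endA h ≟ x) *_) (∑-multiplicity (endB h))) ⟩
    ∑[ h < m G ] (𝟙 (endA h ≟ x) * degB G (endB h))
      ≤⟨ sum-mono-≤ at-x ⟩
    ∑[ h < m G ] (𝟙 (endA h ≟ x) * (σ G ∸ degA G x))
      ≡⟨ *-distribʳ-sum (σ G ∸ degA G x) (λ h → 𝟙 (endA h ≟ x)) ⟨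
    (∑[ h < m G ] 𝟙 (endA h ≟ x)) * (σ G ∸ degA G x)
      ≡⟨ cong (_* (σ G ∸ degA G x)) (countFin≡∑𝟙 endA _≟_ x) ⟨
    degA G x * (σ G ∸ degA G x)
      ∎
    where
    open ≤-Reasoning
    at-x : ∀ h → 𝟙 (endA h ≟ x) * degB G (endB h) ≤ 𝟙 (endA h ≟ x) * (σ G ∸ degA G x)
    at-x h with endA h ≟ x
    ... | yes refl = *-monoʳ-≤ 1 (degB≤σ∸degA h)
    ... | no _     = z≤n

  module _ (C : List (Fin (m G))) where

    cliqueDeg : Fin (a G) → ℕ
    cliqueDeg y = ∑[ e < m G ] (𝟙 (e ∈? C) * 𝟙 (endA e ≟ y))

    length≤∑cliqueDeg : Unique C → length C ≤ ∑[ y < a G ] cliqueDeg y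
    length≤∑cliqueDeg uniq = begin
      length C
        ≤⟨ length≤∑𝟙∈ uniq ⟩
      ∑[ e < m G ] 𝟙 (e ∈? C)
        ≡⟨ sum-cong-≗ 𝟙∈*∑𝟙≟ ⟨
      ∑[ e < m G ] (𝟙 (e ∈? C) * ∑[ y < a G ] 𝟙 (endA e ≟ y))
        ≡⟨ sum-cong-≗ (λ e → *-distribˡ-sum (𝟙 (e ∈? C)) (λ y → 𝟙 (endA e ≟ y))) ⟩
      ∑[ e < m G ] ∑[ y < a G ] (𝟙 (e ∈? C) * 𝟙 (endA e ≟ y))
        ≡⟨ ∑-comm (λ e y → 𝟙 (e ∈? C) * 𝟙 (endA e ≟ y)) ⟩
      ∑[ y < a G ] cliqueDeg y
        ∎
      where
      open ≤-Reasoning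
      𝟙∈*∑𝟙≟ : ∀ e → 𝟙 (e ∈? C) * ∑[ y < a G ] 𝟙 (endA e ≟ y) ≡ 𝟙 (e ∈? C)
      𝟙∈*∑𝟙≟ e = trans (cong (𝟙 (e ∈? C) *_) (∑-𝟙-≟ (endA e))) (*-identityʳ _)

    cliqueDeg≤walks₂ : ∀ {y z} → (∀ {e} → e ∈ C → endA e ≡ y → Reaches z e) →
                       cliqueDeg y ≤ walks₂ z y
    cliqueDeg≤walks₂ {y} {z} reached = sum-mono-≤ termwise
      where
      termwise : ∀ e → 𝟙 (e ∈? C) * 𝟙 (endA e ≟ y) ≤ 𝟙 (endA e ≟ y) * multiplicity z (endB e)
      termwise e with e ∈? C | endA e ≟ y
      ... | yes e∈C | yes e-at-y = ≤-trans (Reaches⇒1≤multiplicity (reached e∈C e-at-y))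
                                           (≤-reflexive (sym (*-identityˡ _)))
      ... | yes _   | no _       = z≤n
      ... | no _    | _          = z≤n

    cliqueDeg≤walks₂-from-max : AllPairs (AdjL² G) C → ∀ {x} → (∀ y → cliqueDeg y ≤ cliqueDeg x) →
                                ∀ y → cliqueDeg y ≤ walks₂ x y
    cliqueDeg≤walks₂-from-max clique {x} x-max y
      with any? (λ e → (e ∈? C) ×-dec (endA e ≟ y) ×-dec ¬? (reaches? x e))
    ... | no ∄unreached = cliqueDeg≤walks₂ (λ {e} e∈C e-at-y →
            decidable-stable (reaches? x e) (λ ¬reach → ∄unreached (e , e∈C , e-at-y , ¬reach)))
    ... | yes (e₁ , e₁∈C , refl , ¬reach₁) = begin
        cliqueDeg (endA e₁)  ≤⟨ x-max (endA e₁) ⟩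
        cliqueDeg x          ≤⟨ cliqueDeg≤walks₂ reached-from-e₁ ⟩
        walks₂ (endA e₁) x   ≡⟨ walks₂-sym (endA e₁) x ⟩
        walks₂ x (endA e₁)   ∎
      where
      open ≤-Reasoning
      reached-from-e₁ : ∀ {e} → e ∈ C → endA e ≡ x → Reaches (endA e₁) e
      reached-from-e₁ {e} e∈C e-at-x with e ≟ e₁
      ... | yes refl = contradiction (e₁ , e-at-x , refl) ¬reach₁
      ... | no e≢e₁  = AdjL²⇒Reaches (allPairs-∈ AdjL²-sym clique e∈C e₁∈C e≢e₁)
                                     (subst (λ v → ¬ Reaches v e₁) (sym e-at-x) ¬reach₁)

theorem3 : (G : BipMultigraph) → (C : List (Fin (m G))) → Unique C → AllPairs (AdjL² G) C →
    4 * length C ≤ σ G * σ G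
theorem3 G []        _    _      = z≤n
theorem3 G C@(e ∷ _) uniq clique =
  ≤-trans (*-monoʳ-≤ 4 length≤degA*[σ∸degA]) (4*[m*[n∸m]]≤n*n (degA G x) (σ G))
  where
  x : Fin (a G)
  x = argmax (cliqueDeg G C) (endA G e) (allFin (a G))
  x-max : ∀ y → cliqueDeg G C y ≤ cliqueDeg G C x
  x-max y = All.lookup (f[xs]≤f[argmax] (endA G e) (allFin (a G))) (∈-allFin y)
  length≤degA*[σ∸degA] : length C ≤ degA G x * (σ G ∸ degA G x)
  length≤degA*[σ∸degA] = begin
    length C                      ≤⟨ length≤∑cliqueDeg G C uniq ⟩
    ∑[ y < a G ] cliqueDeg G C y  ≤⟨ sum-mono-≤ (cliqueDeg≤walks₂-from-max G C clique x-max) ⟩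
    ∑[ y < a G ] walks₂ G x y     ≤⟨ ∑walks₂≤degA*[σ∸degA] G x ⟩
    degA G x * (σ G ∸ degA G x)   ∎
    where open ≤-Reasoning
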